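{- For every integer $r\geq 0$, $$\sum_{k=0}^{r}N_{4k}=\frac{1}{3}\left(N_{4(r+1)}-N_{4r}+N_{4(r-1)}-1\right).$$
   Context: The Narayana numbers $(N_r)_{r\in\mathbb{Z}}$ are defined by $N_0=0$, $N_1=N_2=1$ and $N_r=N_{r-1}+N_{r-3}$ for all integers $r$ (used in both directions, so $N_{ -1}=0$, $N_{ -2}=1$, $N_{ -4}=-1$, etc.). -}

module Defs where

open import Data.Nat using (ℕ; zero; suc)
open import Data.Integer using (ℤ; +_; -[1+_]; _+_; _-_)
open import Data.Product using (_×_; _,_; proj₁)

-- Forward triple: (N_n , N_{n+1} , N_{n+2}) for n ≥ 0.
fwd : ℕ → ℤ × ℤ × ℤ
fwd zero = (+ 0 , + 1 , + 1)
fwd (suc n) with fwd n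
... | (a , b , c) = (b , c , c + a)

-- Backward triple: (N_{-n} , N_{-n+1} , N_{-n+2}) for n ≥ 0.
bwd : ℕ → ℤ × ℤ × ℤ
bwd zero = (+ 0 , + 1 , + 1)
bwd (suc n) with bwd n
... | (a , b , c) = (c - b , a , b)          -- N_{-n-1} = N_{-n+2} - N_{-n+1}

-- Narayana numbers on all integers: N_0 = 0, N_1 = N_2 = 1,
-- N_r = N_{r-1} + N_{r-3} for all r ∈ ℤ.
N : ℤ → ℤ
N (+ n) = proj₁ (fwd n)
N -[1+ n ] = proj₁ (bwd (suc n))

sumTo : ℕ → (ℕ → ℤ) → ℤ
sumTo zero f = f 0
sumTo (suc r) f = sumTo r f + f (suc r)

-- Write M k = N_{4k}.  Unrolling the Narayana recurrence
-- N_{n+3} = N_{n+2} + N_n four times shows that the step-4 subsequence obeys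
--     N_{n+12} = 5 N_{n+8} - 2 N_{n+4} + N_n            (narayana-step-four),
-- i.e. M_{k+3} = 5 M_{k+2} - 2 M_{k+1} + M_k.  For ANY sequence with this
-- recurrence the quantity  3 Σ_{k≤r+1} M_k - (M_{r+2} - M_{r+1} + M_r)  does not
-- depend on r (sum-invariant), by a one-line telescoping computation.  For
-- M_k = N_{4k} its value is -1, read off at r = 0.
--
-- The theorem's case r = 0 involves N_{-4} = -1 and is checked by computation;
-- for r ≥ 1 all indices are non-negative, so the file works with the forward
-- Narayana sequence on ℕ and only translates the integer indices at the end.
module Submission where

open import Defs
open import Data.Nat using (ℕ; zero; suc)
import Data.Nat as ℕ
open import Data.Nat.Properties using (*-distribˡ-+; +-comm)
open import Data.Integer using (ℤ; +_; -[1+_]; _+_; _-_; _*_)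
open import Data.Integer.Properties using (pos-*)
open import Data.Integer.Tactic.RingSolver using (solve-∀)
open import Data.Product using (_,_; proj₁)
open import Relation.Binary.PropositionalEquality
  using (_≡_; refl; sym; trans; cong; cong₂; module ≡-Reasoning)
open ≡-Reasoning

Nℕ : ℕ → ℤ
Nℕ n = proj₁ (fwd n)

narayana-rec : ∀ n → Nℕ (3 ℕ.+ n) ≡ Nℕ (2 ℕ.+ n) + Nℕ n
narayana-rec n with fwd n
... | (a , b , c) = refl

-- The step-4 recurrence N_{n+12} = 5 N_{n+8} - 2 N_{n+4} + N_n.  Both sides
-- satisfy the Narayana recurrence in n, so it suffices to check n = 0, 1, 2.
narayana-step-four : ∀ n → Nℕ (12 ℕ.+ n) ≡ + 5 * Nℕ (8 ℕ.+ n) - + 2 * Nℕ (4 ℕ.+ n) + Nℕ n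
narayana-step-four 0 = refl
narayana-step-four 1 = refl
narayana-step-four 2 = refl
narayana-step-four (suc (suc (suc n))) = begin
  Nℕ (15 ℕ.+ n)
    ≡⟨ narayana-rec (12 ℕ.+ n) ⟩
  Nℕ (14 ℕ.+ n) + Nℕ (12 ℕ.+ n)
    ≡⟨ cong₂ _+_ (narayana-step-four (suc (suc n))) (narayana-step-four n) ⟩
  (+ 5 * Nℕ (10 ℕ.+ n) - + 2 * Nℕ (6 ℕ.+ n) + Nℕ (2 ℕ.+ n))
    + (+ 5 * Nℕ (8 ℕ.+ n) - + 2 * Nℕ (4 ℕ.+ n) + Nℕ n)
    ≡⟨ regroup (Nℕ (10 ℕ.+ n)) (Nℕ (6 ℕ.+ n)) (Nℕ (2 ℕ.+ n))
               (Nℕ (8 ℕ.+ n)) (Nℕ (4 ℕ.+ n)) (Nℕ n) ⟩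
  + 5 * (Nℕ (10 ℕ.+ n) + Nℕ (8 ℕ.+ n)) - + 2 * (Nℕ (6 ℕ.+ n) + Nℕ (4 ℕ.+ n))
    + (Nℕ (2 ℕ.+ n) + Nℕ n)
    ≡⟨ sym (cong₂ (λ x y → + 5 * x - + 2 * y + Nℕ (3 ℕ.+ n))
                  (narayana-rec (8 ℕ.+ n)) (narayana-rec (4 ℕ.+ n))) ⟩
  + 5 * Nℕ (11 ℕ.+ n) - + 2 * Nℕ (7 ℕ.+ n) + Nℕ (3 ℕ.+ n)
    ∎
  where
  regroup : ∀ a b c d e f →
    (+ 5 * a - + 2 * b + c) + (+ 5 * d - + 2 * e + f)
      ≡ + 5 * (a + d) - + 2 * (b + e) + (c + f)
  regroup = solve-∀

sum-invariant : (M : ℕ → ℤ) →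
  (∀ k → M (3 ℕ.+ k) ≡ + 5 * M (2 ℕ.+ k) - + 2 * M (1 ℕ.+ k) + M k) →
  (c : ℤ) → + 3 * sumTo 1 M ≡ M 2 - M 1 + M 0 + c →
  ∀ r → + 3 * sumTo (suc r) M ≡ M (2 ℕ.+ r) - M (1 ℕ.+ r) + M r + c
sum-invariant M rec c base zero = base
sum-invariant M rec c base (suc r) = begin
  + 3 * (sumTo (suc r) M + M (2 ℕ.+ r))
    ≡⟨ distrib (sumTo (suc r) M) (M (2 ℕ.+ r)) ⟩
  + 3 * sumTo (suc r) M + + 3 * M (2 ℕ.+ r)
    ≡⟨ cong (_+ + 3 * M (2 ℕ.+ r)) (sum-invariant M rec c base r) ⟩
  M (2 ℕ.+ r) - M (1 ℕ.+ r) + M r + c + + 3 * M (2 ℕ.+ r)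
    ≡⟨ telescope (M r) (M (1 ℕ.+ r)) (M (2 ℕ.+ r)) c ⟩
  (+ 5 * M (2 ℕ.+ r) - + 2 * M (1 ℕ.+ r) + M r) - M (2 ℕ.+ r) + M (1 ℕ.+ r) + c
    ≡⟨ cong (λ x → x - M (2 ℕ.+ r) + M (1 ℕ.+ r) + c) (sym (rec r)) ⟩
  M (3 ℕ.+ r) - M (2 ℕ.+ r) + M (1 ℕ.+ r) + c
    ∎
  where
  distrib : ∀ s x → + 3 * (s + x) ≡ + 3 * s + + 3 * x
  distrib = solve-∀
  telescope : ∀ x y z d → z - y + x + d + + 3 * z ≡ (+ 5 * z - + 2 * y + x) - z + y + d
  telescope = solve-∀

narayana-mult-four-rec : ∀ k →
  Nℕ (4 ℕ.* (3 ℕ.+ k)) ≡ + 5 * Nℕ (4 ℕ.* (2 ℕ.+ k)) - + 2 * Nℕ (4 ℕ.* (1 ℕ.+ k)) + Nℕ (4 ℕ.* k)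
narayana-mult-four-rec k = begin
  Nℕ (4 ℕ.* (3 ℕ.+ k))
    ≡⟨ cong Nℕ (*-distribˡ-+ 4 3 k) ⟩
  Nℕ (12 ℕ.+ 4 ℕ.* k)
    ≡⟨ narayana-step-four (4 ℕ.* k) ⟩
  + 5 * Nℕ (8 ℕ.+ 4 ℕ.* k) - + 2 * Nℕ (4 ℕ.+ 4 ℕ.* k) + Nℕ (4 ℕ.* k)
    ≡⟨ sym (cong₂ (λ x y → + 5 * Nℕ x - + 2 * Nℕ y + Nℕ (4 ℕ.* k))
                  (*-distribˡ-+ 4 2 k) (*-distribˡ-+ 4 1 k)) ⟩
  + 5 * Nℕ (4 ℕ.* (2 ℕ.+ k)) - + 2 * Nℕ (4 ℕ.* (1 ℕ.+ k)) + Nℕ (4 ℕ.* k)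
    ∎

N-mult-four : ∀ k → N (+ 4 * + k) ≡ Nℕ (4 ℕ.* k)
N-mult-four k = cong N (sym (pos-* 4 k))

sumTo-cong : ∀ r {f g : ℕ → ℤ} → (∀ k → f k ≡ g k) → sumTo r f ≡ sumTo r g
sumTo-cong zero f≡g = f≡g 0
sumTo-cong (suc r) f≡g = cong₂ _+_ (sumTo-cong r f≡g) (f≡g (suc r))

theorem6 : (r : ℕ) → + 3 * sumTo r (λ k → N (+ 4 * + k)) ≡ N (+ 4 * (+ r + + 1)) - N (+ 4 * + r) + N (+ 4 * (+ r - + 1)) - + 1
theorem6 zero = refl
theorem6 (suc r) = begin
  + 3 * sumTo (suc r) (λ k → N (+ 4 * + k))
    ≡⟨ cong (+ 3 *_) (sumTo-cong (suc r) N-mult-four) ⟩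
  + 3 * sumTo (suc r) M
    ≡⟨ sum-invariant M narayana-mult-four-rec -[1+ 0 ] refl r ⟩
  M (2 ℕ.+ r) - M (1 ℕ.+ r) + M r - + 1
    ≡⟨ sym (cong₂ (λ x y → x - M (1 ℕ.+ r) + y - + 1) top-index (N-mult-four r)) ⟩
  N (+ 4 * (+ suc r + + 1)) - N (+ 4 * + suc r) + N (+ 4 * (+ suc r - + 1)) - + 1
    ∎
  where
  M : ℕ → ℤ
  M k = Nℕ (4 ℕ.* k)
  top-index : N (+ 4 * (+ suc r + + 1)) ≡ M (2 ℕ.+ r)
  top-index = trans (N-mult-four (suc r ℕ.+ 1)) (cong M (+-comm (suc r) 1))
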